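{- Let $(c_n)_{n\ge0}$ be a sequence of nonzero numbers with $c_0=1$, let $\omega$ be an umbra with $\omega^n\simeq n!/c_n$, and let $\gamma,\alpha$ be umbrae. Then for all $n\ge k\ge0$, \[ {}_{\omega}(\gamma,\alpha)_{n,k}\simeq\frac{c_n}{c_k\,c_{n-k}}\sum_{i=0}^{n-k}c_i\,\frac{\big(k.\mathfrak K_{\alpha}\big)^{i}}{i!}\;{}_{\omega}(\gamma,\alpha)_{n-k,i}. \]
   Context: Classical umbral calculus: $R=\mathbb{C}[x]$, $A$ a saturated alphabet of umbrae, $E:R[A]\to R$ linear with $E[1]=1$ and $E[\alpha^i\beta^j\cdots]=E[\alpha^i]E[\beta^j]\cdots$ for distinct umbrae; $p\simeq q$ means $E[p]=E[q]$. $f_\alpha(t)=\sum_n E[\alpha^n]t^n/n!$. For an integer $x$ (possibly negative), $x.\alpha$ is an umbra with $(x.\alpha)^n\simeq n![t^n]f_\alpha(t)^x$. For umbrae $\sigma,\alpha$, $\mathfrak K_{\sigma,\alpha}$ is an umbra with $\mathfrak K_{\sigma,\alpha}^0=1$ and $\mathfrak K_{\sigma,\alpha}^n\simeq\sigma(\sigma+(-n).\alpha)^{n-1}$ for $n\ge1$, with $(-n).\alpha$ uncorrelated with $\sigma$; $\mathfrak K_\alpha:=\mathfrak K_{\alpha,\alpha}$. The $\omega$-Riordan array ${}_\omega(\gamma,\alpha)$ is the lower triangular matrix with entries ${}_\omega(\gamma,\alpha)_{n,k}=E\!\left[\frac{c_n}{c_k}\frac{(\gamma+k.\alpha)^{n-k}}{(n-k)!}\right]$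 for $n\ge k\ge0$, where $\gamma$ and $k.\alpha$ are uncorrelated. -}

module Defs where

open import Level using (Level)
open import Algebra.Bundles using (CommutativeRing)
open import Data.Nat using (ℕ; zero; suc; _∸_)
open import Data.Nat.Combinatorics using (_C_)
open import Data.Integer using (ℤ; +_; -[1+_])

-- An umbra α is represented by its moment sequence n ↦ E[α^n] (with E[α^0] = 1),
-- valued in a commutative ring R (the paper: R = ℂ[x]).
module Umbral {c ℓ : Level} (R : CommutativeRing c ℓ) where
  open CommutativeRing R

  Seq : Set c
  Seq = ℕ → Carrier

  ι : ℕ → Carrier
  ι zero    = 0#
  ι (suc n) = 1# + ι n

  sumTo : ℕ → (ℕ → Carrier) → Carrier
  sumTo zero    f = f 0
  sumTo (suc n) f = sumTo n f + f (suc n)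

  -- moments of α + β with α, β uncorrelated:
  -- E[(α+β)^n] = Σ_j C(n,j) E[α^j] E[β^(n-j)]   (product of generating functions)
  conv : Seq → Seq → Seq
  conv a b n = sumTo n (λ j → ι (n C j) * a j * b (n ∸ j))

  -- moments of the augmentation umbra ε (generating function 1)
  unitS : Seq
  unitS zero    = 1#
  unitS (suc _) = 0#

  -- k.α for natural k : generating function f_α(t)^k
  pow : Seq → ℕ → Seq
  pow a zero    = unitS
  pow a (suc k) = conv a (pow a k)

  -- generating function 1/f_α(t) (valid since E[α^0] = 1):
  -- 1/f = Σ_m (1 - f)^m, and (1-f) has zero constant term so only m ≤ n contributes to t^n
  invS : Seq → Seq
  invS a n = sumTo n (λ m → pow (λ j → unitS j - a j) m n)

  -- x.α for an integer x : (x.α)^n ≃ n! [t^n] f_α(t)^x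
  dot : ℤ → Seq → Seq
  dot (+ k)     a = pow a k
  dot -[1+ m ] a = pow (invS a) (suc m)

  -- 𝔎_{σ,α}: 𝔎^0 = 1, 𝔎^n ≃ σ (σ + (-n).α)^(n-1), (-n).α uncorrelated with σ
  kappa : Seq → Seq → Seq
  kappa σ a zero    = 1#
  kappa σ a (suc m) =
    sumTo m (λ j → ι (m C j) * σ (suc j) * dot -[1+ m ] a (m ∸ j))

  kappaSelf : Seq → Seq
  kappaSelf a = kappa a a

  -- inverses of factorials, built from chosen inverses invN n of n+1
  factInv : (ℕ → Carrier) → ℕ → Carrier
  factInv invN zero    = 1#
  factInv invN (suc n) = invN n * factInv invN n

  -- ω-Riordan array entry  _ω(γ,α)_{n,k} = E[ (c_n/c_k) (γ + k.α)^(n-k) / (n-k)! ]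
  -- (cs = (c_n), cinv n = 1/c_n, invN n = 1/(n+1)); meaningful for k ≤ n
  riordan : (invN cs cinv : ℕ → Carrier) → Seq → Seq → ℕ → ℕ → Carrier
  riordan invN cs cinv γ α n k =
    cs n * cinv k * conv γ (dot (+ k) α) (n ∸ k) * factInv invN (n ∸ k)

-- Divide the n-th moment by n!: the exponential generating function map
-- a ↦ egf a turns the binomial convolution `conv` of Defs into the Cauchy product of
-- formal power series.  With A = f_α, G = f_γ and F = f_{𝔎_α}, an ω-Riordan entry is
-- (c_n/c_k)·[t^{n-k}] G·Aᵏ, and the corollary reduces to the coefficient identity
--     [tᵐ] G·Aᵏ = Σ_{i ≤ m} [tⁱ] Fᵏ · [t^{m-i}] G·Aⁱ ,
-- whose right side is [tᵐ] G·(Fᵏ ∘ tA).  So it suffices that F ∘ (tA) = A, which is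
-- Lagrange inversion: H = f_{(-1).α} is the inverse series 1/A, and 𝔎_α is defined
-- precisely so that F′_r = [tʳ] A′·H^{r+1}.

module Submission where

open import Defs
open import Level using (Level)
open import Algebra.Bundles using (CommutativeRing)
open import Data.Nat as ℕ using (ℕ; zero; suc; _≤_; _<_; _∸_; _!; z≤n; s≤s)
import Data.Nat.Properties as ℕP
open import Data.Product using (_,_)
open import Data.Sum using (inj₁; inj₂)
import Relation.Binary.PropositionalEquality as P
open P using (_≡_)
import Algebra.Construct.Pointwise as Pointwise
import Algebra.Properties.Ring as RingProperties
import Algebra.Properties.CommutativeSemigroup as CommutativeSemigroupProperties
import Algebra.Properties.CommutativeSemiring.Exp as CommutativeSemiringExp
import Algebra.Solver.CommutativeMonoid as CommutativeMonoidSolver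
open import Data.Nat.Combinatorics using (_C_; k![n∸k]!∣n!)
open import Data.Nat.Combinatorics.Specification using (nCk≡n!/k![n-k]!)
open import Data.Nat.DivMod using (m/n*n≡m)

module FormalPowerSeries {c ℓ : Level} (R : CommutativeRing c ℓ) where
  open CommutativeRing R
  open Umbral R
  open import Relation.Binary.Reasoning.Setoid setoid
  open RingProperties ring
    using (-0#≈0#; x[y-z]≈xy-xz; x∙y⁻¹≈ε⇒x≈y; x≈y⇒x∙y⁻¹≈ε; x≈z//y; //-rightDividesˡ)
  open CommutativeSemigroupProperties +-commutativeSemigroup using ()
    renaming (interchange to +-interchange)
  open CommutativeSemigroupProperties *-commutativeSemigroup using (x∙yz≈y∙xz; interchange)
  open CommutativeMonoidSolver *-commutativeMonoid using (solve; _⊕_; _⊜_)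

  sum-cong : ∀ n {f g : ℕ → Carrier} → (∀ i → i ≤ n → f i ≈ g i) → sumTo n f ≈ sumTo n g
  sum-cong zero    f≈g = f≈g 0 z≤n
  sum-cong (suc n) f≈g =
    +-cong (sum-cong n (λ i i≤n → f≈g i (ℕP.m≤n⇒m≤1+n i≤n))) (f≈g (suc n) ℕP.≤-refl)

  sum-cong′ : ∀ n {f g : ℕ → Carrier} → (∀ i → f i ≈ g i) → sumTo n f ≈ sumTo n g
  sum-cong′ n f≈g = sum-cong n (λ i _ → f≈g i)

  sum-+ : ∀ n (f g : ℕ → Carrier) → sumTo n (λ i → f i + g i) ≈ sumTo n f + sumTo n g
  sum-+ zero    f g = refl
  sum-+ (suc n) f g = trans (+-congʳ (sum-+ n f g)) (+-interchange _ _ _ _)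

  sum-*ˡ : ∀ n x (f : ℕ → Carrier) → x * sumTo n f ≈ sumTo n (λ i → x * f i)
  sum-*ˡ zero    x f = refl
  sum-*ˡ (suc n) x f = trans (distribˡ x _ _) (+-congʳ (sum-*ˡ n x f))

  sum-*ʳ : ∀ n x (f : ℕ → Carrier) → sumTo n f * x ≈ sumTo n (λ i → f i * x)
  sum-*ʳ zero    x f = refl
  sum-*ʳ (suc n) x f = trans (distribʳ x _ _) (+-congʳ (sum-*ʳ n x f))

  sum-zero : ∀ n {f : ℕ → Carrier} → (∀ i → i ≤ n → f i ≈ 0#) → sumTo n f ≈ 0#
  sum-zero zero    f≈0 = f≈0 0 z≤n
  sum-zero (suc n) f≈0 =
    trans (+-cong (sum-zero n (λ i i≤n → f≈0 i (ℕP.m≤n⇒m≤1+n i≤n))) (f≈0 (suc n) ℕP.≤-refl))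
          (+-identityʳ 0#)

  sum-extend : ∀ {m} n {f : ℕ → Carrier} → m ≤ n → (∀ i → m < i → i ≤ n → f i ≈ 0#) →
               sumTo n f ≈ sumTo m f
  sum-extend zero    z≤n  _   = refl
  sum-extend (suc n) m≤1+n f≈0 with ℕP.m≤n⇒m<n∨m≡n m≤1+n
  ... | inj₂ P.refl       = refl
  ... | inj₁ (s≤s m≤n)    =
    trans (+-cong (sum-extend n m≤n (λ i m<i i≤n → f≈0 i m<i (ℕP.m≤n⇒m≤1+n i≤n)))
                  (f≈0 (suc n) (s≤s m≤n) ℕP.≤-refl))
          (+-identityʳ _)

  sum-swap : ∀ n m (f : ℕ → ℕ → Carrier) →
             sumTo n (λ i → sumTo m (f i)) ≈ sumTo m (λ j → sumTo n (λ i → f i j))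
  sum-swap zero    m f = refl
  sum-swap (suc n) m f = trans (+-congʳ (sum-swap n m f)) (sym (sum-+ m _ _))

  sum-peel : ∀ n (f : ℕ → Carrier) → sumTo (suc n) f ≈ f 0 + sumTo n (λ i → f (suc i))
  sum-peel zero    f = refl
  sum-peel (suc n) f = trans (+-congʳ (sum-peel n f)) (+-assoc _ _ _)

  sum-reverse : ∀ n (f : ℕ → Carrier) → sumTo n f ≈ sumTo n (λ i → f (n ∸ i))
  sum-reverse zero    f = refl
  sum-reverse (suc n) f =
    trans (+-congʳ (sum-reverse n f))
          (trans (+-comm _ _) (sym (sum-peel n (λ i → f (suc n ∸ i)))))

  sum-antidiagonal : ∀ q (f : ℕ → ℕ → Carrier) →
    sumTo q (λ i → sumTo i (λ p → f p (i ∸ p))) ≈ sumTo q (λ p → sumTo (q ∸ p) (f p))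
  sum-antidiagonal zero    f = refl
  sum-antidiagonal (suc q) f = begin
      sumTo q (λ i → sumTo i (λ p → f p (i ∸ p))) + sumTo (suc q) (λ p → f p (suc q ∸ p))
    ≈⟨ +-congʳ (sum-antidiagonal q f) ⟩
      sumTo q (λ p → sumTo (q ∸ p) (f p))
        + (sumTo q (λ p → f p (suc q ∸ p)) + f (suc q) (q ∸ q))
    ≈⟨ sym (+-assoc _ _ _) ⟩
      (sumTo q (λ p → sumTo (q ∸ p) (f p)) + sumTo q (λ p → f p (suc q ∸ p)))
        + f (suc q) (q ∸ q)
    ≈⟨ +-cong (sym (sum-+ q _ _)) (reflexive (P.cong (f (suc q)) (ℕP.n∸n≡0 q))) ⟩
      sumTo q (λ p → sumTo (q ∸ p) (f p) + f p (suc q ∸ p)) + f (suc q) 0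
    ≈⟨ +-cong (sum-cong q (λ p p≤q → reflexive (P.sym (grow (f p) p≤q))))
              (reflexive (P.cong (λ z → sumTo z (f (suc q))) (P.sym (ℕP.n∸n≡0 q)))) ⟩
      sumTo q (λ p → sumTo (suc q ∸ p) (f p)) + sumTo (suc q ∸ suc q) (f (suc q))
    ∎
    where
      grow : ∀ {p} (g : ℕ → Carrier) → p ≤ q → sumTo (suc q ∸ p) g ≡ sumTo (q ∸ p) g + g (suc q ∸ p)
      grow {p} g p≤q rewrite ℕP.+-∸-assoc 1 p≤q = P.refl

  sum-delta : ∀ n (g : ℕ → Carrier) → sumTo n (λ i → unitS i * g i) ≈ g 0
  sum-delta zero    g = *-identityˡ _
  sum-delta (suc n) g = trans (+-cong (sum-delta n g) (zeroˡ _)) (+-identityʳ _)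

  sum-telescope : ∀ n (y : ℕ → Carrier) → sumTo n (λ m → y m - y (suc m)) ≈ y 0 - y (suc n)
  sum-telescope zero    y = refl
  sum-telescope (suc n) y = begin
      sumTo n (λ m → y m - y (suc m)) + (y (suc n) - y (suc (suc n)))
    ≈⟨ +-congʳ (sum-telescope n y) ⟩
      (y 0 - y (suc n)) + (y (suc n) - y (suc (suc n)))
    ≈⟨ +-assoc _ _ _ ⟩
      y 0 + (- y (suc n) + (y (suc n) - y (suc (suc n))))
    ≈⟨ +-congˡ (sym (+-assoc _ _ _)) ⟩
      y 0 + ((- y (suc n) + y (suc n)) - y (suc (suc n)))
    ≈⟨ +-congˡ (trans (+-congʳ (-‿inverseˡ _)) (+-identityˡ _)) ⟩
      y 0 - y (suc (suc n))
    ∎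

  ι-+ : ∀ m n → ι (m ℕ.+ n) ≈ ι m + ι n
  ι-+ zero    n = sym (+-identityˡ _)
  ι-+ (suc m) n = trans (+-congˡ (ι-+ m n)) (sym (+-assoc _ _ _))

  ι-* : ∀ m n → ι (m ℕ.* n) ≈ ι m * ι n
  ι-* zero    n = sym (zeroˡ _)
  ι-* (suc m) n = begin
    ι (n ℕ.+ m ℕ.* n)     ≈⟨ ι-+ n (m ℕ.* n) ⟩
    ι n + ι (m ℕ.* n)     ≈⟨ +-cong (sym (*-identityˡ _)) (ι-* m n) ⟩
    1# * ι n + ι m * ι n  ≈⟨ sym (distribʳ _ _ _) ⟩
    ι (suc m) * ι n       ∎

  ι-∸ : ∀ {j n} → j ≤ n → ι n ≈ ι j + ι (n ∸ j)
  ι-∸ {j} {n} j≤n = trans (reflexive (P.cong ι (P.sym (ℕP.m+[n∸m]≡n j≤n)))) (ι-+ j (n ∸ j))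

  infix 4 _≐_
  _≐_ : Seq → Seq → Set ℓ
  X ≐ Y = ∀ n → X n ≈ Y n

  infixl 6 _⊞_
  _⊞_ : Seq → Seq → Seq
  (X ⊞ Y) n = X n + Y n

  ⊟_ : Seq → Seq
  (⊟ X) n = - X n

  𝟘 : Seq
  𝟘 _ = 0#

  infixl 7 _⋆_
  _⋆_ : Seq → Seq → Seq
  (X ⋆ Y) n = sumTo n (λ j → X j * Y (n ∸ j))

  ⋆-cong : ∀ {X X′ Y Y′} → X ≐ X′ → Y ≐ Y′ → X ⋆ Y ≐ X′ ⋆ Y′
  ⋆-cong X≐X′ Y≐Y′ n = sum-cong′ n (λ j → *-cong (X≐X′ j) (Y≐Y′ (n ∸ j)))

  ⋆-congˡ : ∀ X {Y Y′} → Y ≐ Y′ → X ⋆ Y ≐ X ⋆ Y′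
  ⋆-congˡ X {Y} {Y′} = ⋆-cong {X} {X} {Y} {Y′} (λ _ → refl)

  ⋆-congʳ : ∀ Y {X X′} → X ≐ X′ → X ⋆ Y ≐ X′ ⋆ Y
  ⋆-congʳ Y {X} {X′} X≐X′ = ⋆-cong {X} {X′} {Y} {Y} X≐X′ (λ _ → refl)

  ⋆-comm : ∀ X Y → X ⋆ Y ≐ Y ⋆ X
  ⋆-comm X Y n = trans (sum-reverse n _) (sum-cong n (λ j j≤n →
    trans (*-comm _ _) (*-congʳ (reflexive (P.cong Y (ℕP.m∸[m∸n]≡n j≤n))))))

  ⋆-identityʳ : ∀ X → X ⋆ unitS ≐ X
  ⋆-identityʳ X zero    = *-identityʳ _
  ⋆-identityʳ X (suc n) = begin
      sumTo n (λ j → X j * unitS (suc n ∸ j)) + X (suc n) * unitS (n ∸ n)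
    ≈⟨ +-cong (sum-zero n (λ j j≤n → trans (*-congˡ (reflexive (P.cong unitS (ℕP.+-∸-assoc 1 j≤n))))
                                              (zeroʳ _)))
              (*-congˡ (reflexive (P.cong unitS (ℕP.n∸n≡0 n)))) ⟩
      0# + X (suc n) * 1#
    ≈⟨ trans (+-identityˡ _) (*-identityʳ _) ⟩
      X (suc n)
    ∎

  ⋆-identityˡ : ∀ X → unitS ⋆ X ≐ X
  ⋆-identityˡ X n = trans (⋆-comm unitS X n) (⋆-identityʳ X n)

  ⋆-distribˡ : ∀ Z X Y → Z ⋆ (X ⊞ Y) ≐ Z ⋆ X ⊞ Z ⋆ Y
  ⋆-distribˡ Z X Y n = trans (sum-cong′ n (λ j → distribˡ _ _ _)) (sum-+ n _ _)

  ⋆-distribʳ : ∀ Z X Y → (X ⊞ Y) ⋆ Z ≐ X ⋆ Z ⊞ Y ⋆ Z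
  ⋆-distribʳ Z X Y n = trans (sum-cong′ n (λ j → distribʳ _ _ _)) (sum-+ n _ _)

  -- Associativity: both sides sum X_p Y_s Z_{q-p-s} over the triangle p + s ≤ q.
  ⋆-assoc : ∀ X Y Z → (X ⋆ Y) ⋆ Z ≐ X ⋆ (Y ⋆ Z)
  ⋆-assoc X Y Z q = begin
      sumTo q (λ i → sumTo i (λ p → X p * Y (i ∸ p)) * Z (q ∸ i))
    ≈⟨ sum-cong q (λ i i≤q → trans (sum-*ʳ i _ _) (sum-cong i (λ p p≤i →
         *-congˡ (reflexive (P.cong (λ z → Z (q ∸ z)) (P.sym (ℕP.m+[n∸m]≡n p≤i))))))) ⟩
      sumTo q (λ i → sumTo i (λ p → term p (i ∸ p)))
    ≈⟨ sum-antidiagonal q term ⟩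
      sumTo q (λ p → sumTo (q ∸ p) (term p))
    ≈⟨ sum-cong′ q (λ p → trans (sum-cong′ (q ∸ p) (λ s →
         trans (*-assoc _ _ _) (*-congˡ (*-congˡ (reflexive (P.cong Z (P.sym (ℕP.∸-+-assoc q p s))))))))
         (sym (sum-*ˡ (q ∸ p) (X p) _))) ⟩
      sumTo q (λ p → X p * sumTo (q ∸ p) (λ s → Y s * Z (q ∸ p ∸ s)))
    ∎
    where
      term : ℕ → ℕ → Carrier
      term p s = X p * Y s * Z (q ∸ (p ℕ.+ s))

  Series : CommutativeRing c ℓ
  Series = record
    { Carrier = Seq ; _≈_ = _≐_ ; _+_ = _⊞_ ; _*_ = _⋆_ ; -_ = ⊟_ ; 0# = 𝟘 ; 1# = unitS
    ; isCommutativeRing = record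
      { isRing = record
        { +-isAbelianGroup = Pointwise.isAbelianGroup ℕ +-isAbelianGroup
        ; *-cong           = ⋆-cong
        ; *-assoc          = ⋆-assoc
        ; *-identity       = ⋆-identityˡ , ⋆-identityʳ
        ; distrib          = ⋆-distribˡ , ⋆-distribʳ
        }
      ; *-comm = ⋆-comm
      }
    }

  module 𝓢 = CommutativeRing Series
  module 𝓢-Properties = RingProperties 𝓢.ring
  module 𝓢-Rearrange = CommutativeSemigroupProperties 𝓢.*-commutativeSemigroup
  open CommutativeSemiringExp 𝓢.commutativeSemiring using (_^_) public
  open CommutativeSemiringExp 𝓢.commutativeSemiring using (^-congˡ; ^-homo-*; ^-distrib-*)

  ⋆-scaleʳ : ∀ x X Y W → (∀ l → W l ≈ x * Y l) → ∀ n → (X ⋆ W) n ≈ x * (X ⋆ Y) n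
  ⋆-scaleʳ x X Y W W≈xY n = trans (sum-cong′ n (λ j → trans (*-congˡ (W≈xY (n ∸ j))) (x∙yz≈y∙xz _ _ _)))
                                  (sym (sum-*ˡ n x _))

  ⋆-scaleˡ : ∀ x X Y W → (∀ l → W l ≈ x * Y l) → ∀ n → (W ⋆ X) n ≈ x * (Y ⋆ X) n
  ⋆-scaleˡ x X Y W W≈xY n =
    trans (⋆-comm W X n) (trans (⋆-scaleʳ x X Y W W≈xY n) (*-congˡ (⋆-comm X Y n)))

  ⋆-leading : ∀ X Y r → (∀ l → l < r → X l ≈ 0#) → (X ⋆ Y) r ≈ X r * Y 0
  ⋆-leading X Y zero    _   = refl
  ⋆-leading X Y (suc r) X≈0 = begin
      sumTo r (λ j → X j * Y (suc r ∸ j)) + X (suc r) * Y (r ∸ r)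
    ≈⟨ +-cong (sum-zero r (λ j j≤r → trans (*-congʳ (X≈0 j (s≤s j≤r))) (zeroˡ _)))
              (*-congˡ (reflexive (P.cong Y (ℕP.n∸n≡0 r)))) ⟩
      0# + X (suc r) * Y 0
    ≈⟨ +-identityˡ _ ⟩
      X (suc r) * Y 0
    ∎

  ^-vanish : ∀ X → X 0 ≈ 0# → ∀ k q → q < k → (X ^ k) q ≈ 0#
  ^-vanish X X₀≈0 (suc k) q (s≤s q≤k) = sum-zero q term≈0
    where
      term≈0 : ∀ j → j ≤ q → X j * (X ^ k) (q ∸ j) ≈ 0#
      term≈0 zero    _     = trans (*-congʳ X₀≈0) (zeroˡ _)
      term≈0 (suc j) 1+j≤q =
        trans (*-congˡ (^-vanish X X₀≈0 k (q ∸ suc j) (ℕP.<-≤-trans (ℕP.∸-monoʳ-< (s≤s z≤n) 1+j≤q) q≤k)))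
              (zeroʳ _)

  ^-constant : ∀ X → X 0 ≈ 1# → ∀ k → (X ^ k) 0 ≈ 1#
  ^-constant X X₀≈1 zero    = refl
  ^-constant X X₀≈1 (suc k) = trans (*-cong X₀≈1 (^-constant X X₀≈1 k)) (*-identityʳ _)

  δ-off : ∀ {j r} → j < r → unitS (r ∸ j) ≈ 0#
  δ-off {j} {r} j<r with r ∸ j | ℕP.m<n⇒0<n∸m j<r
  ... | suc _ | _ = refl

  𝟙-^ : ∀ k → unitS ^ k ≐ unitS
  𝟙-^ zero    = 𝓢.refl
  𝟙-^ (suc k) = 𝓢.trans (⋆-identityˡ _) (𝟙-^ k)

  ∂ : Seq → Seq
  ∂ X n = ι (suc n) * X (suc n)

  ∂-cong : ∀ {X Y} → X ≐ Y → ∂ X ≐ ∂ Y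
  ∂-cong X≐Y n = *-congˡ (X≐Y (suc n))

  ∂-𝟙 : ∂ unitS ≐ 𝟘
  ∂-𝟙 n = zeroʳ _

  -- Product rule: (n+1) = j + (n+1-j) splits each term of (XY)_{n+1}.
  leibniz : ∀ X Y → ∂ (X ⋆ Y) ≐ ∂ X ⋆ Y ⊞ X ⋆ ∂ Y
  leibniz X Y n = begin
      ι (suc n) * sumTo (suc n) (λ j → X j * Y (suc n ∸ j))
    ≈⟨ sum-*ˡ (suc n) _ _ ⟩
      sumTo (suc n) (λ j → ι (suc n) * (X j * Y (suc n ∸ j)))
    ≈⟨ sum-cong (suc n) (λ j j≤ → trans (*-congʳ (ι-∸ j≤)) (distribʳ _ _ _)) ⟩
      sumTo (suc n) (λ j → ι j * (X j * Y (suc n ∸ j)) + ι (suc n ∸ j) * (X j * Y (suc n ∸ j)))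
    ≈⟨ sum-+ (suc n) _ _ ⟩
      sumTo (suc n) (λ j → ι j * (X j * Y (suc n ∸ j)))
        + sumTo (suc n) (λ j → ι (suc n ∸ j) * (X j * Y (suc n ∸ j)))
    ≈⟨ +-cong derivativeOnLeft derivativeOnRight ⟩
      (∂ X ⋆ Y) n + (X ⋆ ∂ Y) n
    ∎
    where
      derivativeOnLeft : sumTo (suc n) (λ j → ι j * (X j * Y (suc n ∸ j))) ≈ (∂ X ⋆ Y) n
      derivativeOnLeft = begin
          sumTo (suc n) (λ j → ι j * (X j * Y (suc n ∸ j)))
        ≈⟨ sum-peel n _ ⟩
          0# * (X 0 * Y (suc n)) + sumTo n (λ j → ι (suc j) * (X (suc j) * Y (n ∸ j)))
        ≈⟨ trans (+-congʳ (zeroˡ _)) (+-identityˡ _) ⟩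
          sumTo n (λ j → ι (suc j) * (X (suc j) * Y (n ∸ j)))
        ≈⟨ sum-cong′ n (λ j → sym (*-assoc _ _ _)) ⟩
          (∂ X ⋆ Y) n
        ∎
      derivativeOnRight : sumTo (suc n) (λ j → ι (suc n ∸ j) * (X j * Y (suc n ∸ j))) ≈ (X ⋆ ∂ Y) n
      derivativeOnRight = begin
          sumTo n (λ j → ι (suc n ∸ j) * (X j * Y (suc n ∸ j)))
            + ι (suc n ∸ suc n) * (X (suc n) * Y (suc n ∸ suc n))
        ≈⟨ +-cong (sum-cong n (λ j j≤n → reflexive (P.cong (λ z → ι z * (X j * Y z)) (ℕP.+-∸-assoc 1 j≤n))))
                  (reflexive (P.cong (λ z → ι z * (X (suc n) * Y z)) (ℕP.n∸n≡0 n))) ⟩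
          sumTo n (λ j → ι (suc (n ∸ j)) * (X j * Y (suc (n ∸ j)))) + 0# * (X (suc n) * Y 0)
        ≈⟨ trans (+-congˡ (zeroˡ _)) (+-identityʳ _) ⟩
          sumTo n (λ j → ι (suc (n ∸ j)) * (X j * Y (suc (n ∸ j))))
        ≈⟨ sum-cong′ n (λ j → x∙yz≈y∙xz _ _ _) ⟩
          (X ⋆ ∂ Y) n
        ∎

  ∂-^ : ∀ X j n → ∂ (X ^ suc j) n ≈ ι (suc j) * (X ^ j ⋆ ∂ X) n
  ∂-^ X zero    n = begin
      ∂ (X ⋆ unitS) n        ≈⟨ ∂-cong (⋆-identityʳ X) n ⟩
      ∂ X n                  ≈⟨ sym (⋆-identityˡ (∂ X) n) ⟩
      (unitS ⋆ ∂ X) n        ≈⟨ sym (*-identityˡ _) ⟩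
      1# * (unitS ⋆ ∂ X) n   ≈⟨ *-congʳ (sym (+-identityʳ 1#)) ⟩
      ι 1 * (unitS ⋆ ∂ X) n  ∎
  ∂-^ X (suc j) n = begin
      ∂ (X ⋆ X ^ suc j) n
    ≈⟨ leibniz X (X ^ suc j) n ⟩
      (∂ X ⋆ X ^ suc j) n + (X ⋆ ∂ (X ^ suc j)) n
    ≈⟨ +-cong (⋆-comm (∂ X) (X ^ suc j) n) (⋆-scaleʳ (ι (suc j)) X (X ^ j ⋆ ∂ X) _ (∂-^ X j) n) ⟩
      (X ^ suc j ⋆ ∂ X) n + ι (suc j) * (X ⋆ (X ^ j ⋆ ∂ X)) n
    ≈⟨ +-congˡ (*-congˡ (sym (⋆-assoc X (X ^ j) (∂ X) n))) ⟩
      (X ^ suc j ⋆ ∂ X) n + ι (suc j) * (X ^ suc j ⋆ ∂ X) n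
    ≈⟨ sym (trans (distribʳ _ _ _) (+-congʳ (*-identityˡ _))) ⟩
      ι (suc (suc j)) * (X ^ suc j ⋆ ∂ X) n
    ∎

  𝐭 : Seq
  𝐭 zero    = 0#
  𝐭 (suc n) = unitS n

  𝐭⋆-zero : ∀ X → (𝐭 ⋆ X) 0 ≈ 0#
  𝐭⋆-zero X = zeroˡ _

  𝐭⋆-suc : ∀ X n → (𝐭 ⋆ X) (suc n) ≈ X n
  𝐭⋆-suc X n = begin
      (𝐭 ⋆ X) (suc n)                                        ≈⟨ sum-peel n _ ⟩
      0# * X (suc n) + sumTo n (λ j → unitS j * X (n ∸ j))   ≈⟨ trans (+-congʳ (zeroˡ _)) (+-identityˡ _) ⟩
      sumTo n (λ j → unitS j * X (n ∸ j))                    ≈⟨ sum-delta n (λ j → X (n ∸ j)) ⟩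
      X n                                                     ∎

  𝐭^⋆ : ∀ i X q → i ≤ q → (𝐭 ^ i ⋆ X) q ≈ X (q ∸ i)
  𝐭^⋆ zero    X q       _         = ⋆-identityˡ X q
  𝐭^⋆ (suc i) X (suc q) (s≤s i≤q) = begin
      ((𝐭 ⋆ 𝐭 ^ i) ⋆ X) (suc q)  ≈⟨ ⋆-assoc 𝐭 (𝐭 ^ i) X (suc q) ⟩
      (𝐭 ⋆ (𝐭 ^ i ⋆ X)) (suc q)  ≈⟨ 𝐭⋆-suc (𝐭 ^ i ⋆ X) q ⟩
      (𝐭 ^ i ⋆ X) q              ≈⟨ 𝐭^⋆ i X q i≤q ⟩
      X (q ∸ i)                  ∎

  ∂𝐭 : ∂ 𝐭 ≐ unitS
  ∂𝐭 zero    = trans (*-identityʳ _) (+-identityʳ _)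
  ∂𝐭 (suc n) = zeroʳ _

  ⋆-linearˡ : ∀ N (X : ℕ → Carrier) (V : ℕ → Seq) W Y r →
              (∀ l → l ≤ r → W l ≈ sumTo N (λ i → X i * V i l)) →
              (W ⋆ Y) r ≈ sumTo N (λ i → X i * (V i ⋆ Y) r)
  ⋆-linearˡ N X V W Y r W≈ΣXV = begin
      sumTo r (λ l → W l * Y (r ∸ l))
    ≈⟨ sum-cong r (λ l l≤r → trans (*-congʳ (W≈ΣXV l l≤r)) (sum-*ʳ N _ _)) ⟩
      sumTo r (λ l → sumTo N (λ i → X i * V i l * Y (r ∸ l)))
    ≈⟨ sum-swap r N _ ⟩
      sumTo N (λ i → sumTo r (λ l → X i * V i l * Y (r ∸ l)))
    ≈⟨ sum-cong′ N (λ i → trans (sum-cong′ r (λ l → *-assoc _ _ _)) (sym (sum-*ˡ r (X i) _))) ⟩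
      sumTo N (λ i → X i * (V i ⋆ Y) r)
    ∎

  -- Composition X ∘ u with a series u without constant term:
  --   (X ∘ u)_q = Σ_{i ≤ q} X_i (uⁱ)_q ,
  -- a finite sum since uⁱ vanishes below degree i.  It is multiplicative.
  module Composition (u : Seq) (u₀≈0 : u 0 ≈ 0#) where

    infixl 9 _∘u
    _∘u : Seq → Seq
    (X ∘u) q = sumTo q (λ i → X i * (u ^ i) q)

    ∘u-extend : ∀ X {q N} → q ≤ N → (X ∘u) q ≈ sumTo N (λ i → X i * (u ^ i) q)
    ∘u-extend X q≤N = sym (sum-extend _ q≤N (λ i q<i _ →
      trans (*-congˡ (^-vanish u u₀≈0 i _ q<i)) (zeroʳ _)))

    𝟙∘u : unitS ∘u ≐ unitS
    𝟙∘u q = sum-delta q (λ i → (u ^ i) q)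

    -- (XY) ∘ u = (X ∘ u)(Y ∘ u): expand both sides into Σ_{p,s,a} X_p Y_s (uᵖ)_a (uˢ)_{q-a}.
    ⋆-∘u : ∀ X Y → (X ⋆ Y) ∘u ≐ X ∘u ⋆ Y ∘u
    ⋆-∘u X Y q = begin
        sumTo q (λ i → sumTo i (λ p → X p * Y (i ∸ p)) * (u ^ i) q)
      ≈⟨ sum-cong q (λ i _ → trans (sum-*ʳ i _ _) (sum-cong i (λ p p≤i →
           *-congˡ (reflexive (P.cong (λ z → (u ^ z) q) (P.sym (ℕP.m+[n∸m]≡n p≤i))))))) ⟩
        sumTo q (λ i → sumTo i (λ p → term p (i ∸ p)))
      ≈⟨ sum-antidiagonal q term ⟩
        sumTo q (λ p → sumTo (q ∸ p) (term p))
      ≈⟨ sum-cong′ q (λ p → sym (sum-extend q (ℕP.m∸n≤m q p) (λ s q∸p<s _ →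
           trans (*-congˡ (^-vanish u u₀≈0 (p ℕ.+ s) q (q<p+s q∸p<s))) (zeroʳ _)))) ⟩
        sumTo q (λ p → sumTo q (term p))
      ≈⟨ sum-cong′ q (λ p → sum-cong′ q (λ s → trans (*-congˡ (^-homo-* u p s q))
           (trans (sum-*ˡ q _ _) (sum-cong′ q (λ a → interchange _ _ _ _))))) ⟩
        sumTo q (λ p → sumTo q (λ s → sumTo q (λ a → (X p * (u ^ p) a) * (Y s * (u ^ s) (q ∸ a)))))
      ≈⟨ trans (sum-cong′ q (λ p → sum-swap q q _)) (sum-swap q q _) ⟩
        sumTo q (λ a → sumTo q (λ p → sumTo q (λ s → (X p * (u ^ p) a) * (Y s * (u ^ s) (q ∸ a)))))
      ≈⟨ sum-cong′ q (λ a → trans (sum-cong′ q (λ p → sym (sum-*ˡ q _ _))) (sym (sum-*ʳ q _ _))) ⟩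
        sumTo q (λ a → sumTo q (λ p → X p * (u ^ p) a) * sumTo q (λ s → Y s * (u ^ s) (q ∸ a)))
      ≈⟨ sum-cong q (λ a a≤q → sym (*-cong (∘u-extend X a≤q) (∘u-extend Y (ℕP.m∸n≤m q a)))) ⟩
        (X ∘u ⋆ Y ∘u) q
      ∎
      where
        term : ℕ → ℕ → Carrier
        term p s = X p * Y s * (u ^ (p ℕ.+ s)) q
        q<p+s : ∀ {p s} → q ∸ p < s → q < p ℕ.+ s
        q<p+s {p} q∸p<s = ℕP.≤-<-trans (ℕP.m≤n+m∸n q p) (ℕP.+-monoʳ-< p q∸p<s)

    ∂-∘u : ∀ X {l N} → suc l ≤ N → ∂ (X ∘u) l ≈ sumTo N (λ i → X i * ∂ (u ^ i) l)
    ∂-∘u X {l} {N} l<N = trans (*-congˡ (∘u-extend X l<N)) (trans (sum-*ˡ N (ι (suc l)) _)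
      (sum-cong′ N (λ i → x∙yz≈y∙xz (ι (suc l)) (X i) ((u ^ i) (suc l)))))

    ^-∘u : ∀ X k → (X ^ k) ∘u ≐ X ∘u ^ k
    ^-∘u X zero    = 𝟙∘u
    ^-∘u X (suc k) = 𝓢.trans (⋆-∘u X (X ^ k)) (⋆-congˡ (X ∘u) (^-∘u X k))

  -- The geometric series Σ_m Eᵐ of a series E with E₀ = 0; its degree-n coefficient
  -- only involves the powers m ≤ n.
  geometric : Seq → Seq
  geometric E n = sumTo n (λ m → (E ^ m) n)

  geometric-inverse : ∀ E → E 0 ≈ 0# → (unitS 𝓢.- E) ⋆ geometric E ≐ unitS
  geometric-inverse E E₀≈0 n = begin
      sumTo n (λ j → (unitS 𝓢.- E) j * sumTo (n ∸ j) (λ m → (E ^ m) (n ∸ j)))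
    ≈⟨ sum-cong n (λ j j≤n → *-congˡ (sym (sum-extend n (ℕP.m∸n≤m n j) (λ m n∸j<m _ →
         ^-vanish E E₀≈0 m (n ∸ j) n∸j<m)))) ⟩
      sumTo n (λ j → (unitS 𝓢.- E) j * sumTo n (λ m → (E ^ m) (n ∸ j)))
    ≈⟨ trans (sum-cong′ n (λ j → sum-*ˡ n _ _)) (sum-swap n n _) ⟩
      sumTo n (λ m → ((unitS 𝓢.- E) ⋆ E ^ m) n)
    ≈⟨ sum-cong′ n (λ m → trans (𝓢-Properties.[y-z]x≈yx-zx (E ^ m) unitS E n)
                                 (+-congʳ (⋆-identityˡ (E ^ m) n))) ⟩
      sumTo n (λ m → (E ^ m) n - (E ^ suc m) n)
    ≈⟨ sum-telescope n (λ m → (E ^ m) n) ⟩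
      unitS n - (E ^ suc n) n
    ≈⟨ +-congˡ (trans (-‿cong (^-vanish E E₀≈0 (suc n) n ℕP.≤-refl)) -0#≈0#) ⟩
      unitS n + 0#
    ≈⟨ +-identityʳ _ ⟩
      unitS n
    ∎

  module LagrangeInversion
    (ι-cancel : ∀ n {x y} → ι (suc n) * x ≈ ι (suc n) * y → x ≈ y)
    (A H F : Seq) (A₀≈1 : A 0 ≈ 1#) (A⋆H≐𝟙 : A ⋆ H ≐ unitS)
    (F₀≈1 : F 0 ≈ 1#) (∂F : ∀ r → ∂ F r ≈ (∂ A ⋆ H ^ suc r) r) where

    u : Seq
    u = 𝐭 ⋆ A

    open Composition u (𝐭⋆-zero A)

    H⋆A≐𝟙 : H ⋆ A ≐ unitS
    H⋆A≐𝟙 = 𝓢.trans (⋆-comm H A) A⋆H≐𝟙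

    H₀≈1 : H 0 ≈ 1#
    H₀≈1 = trans (sym (trans (*-congʳ A₀≈1) (*-identityˡ _))) (A⋆H≐𝟙 0)

    cancel-powers : ∀ i s → A ^ i ⋆ H ^ (i ℕ.+ s) ≐ H ^ s
    cancel-powers i s =
      𝓢.trans (⋆-congˡ (A ^ i) (^-homo-* H i s))
     (𝓢.trans (𝓢.sym (⋆-assoc (A ^ i) (H ^ i) (H ^ s)))
     (𝓢.trans (⋆-congʳ (H ^ s) (𝓢.trans (𝓢.sym (^-distrib-* A H i))
                                       (𝓢.trans (^-congˡ i A⋆H≐𝟙) (𝟙-^ i))))
              (⋆-identityˡ (H ^ s))))

    ∂H : H ^ 2 ⋆ ∂ A ≐ ⊟ ∂ H
    ∂H = 𝓢-Properties.+-inverseˡ-unique (H ^ 2 ⋆ ∂ A) (∂ H) sum≐𝟘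
      where
        sum≐𝟘 : H ^ 2 ⋆ ∂ A ⊞ ∂ H ≐ 𝟘
        sum≐𝟘 n = begin
            (H ^ 2 ⋆ ∂ A) n + ∂ H n
          ≈⟨ +-cong (⋆-congʳ (∂ A) (⋆-congˡ H (⋆-identityʳ H)) n)
                    (sym (trans (⋆-congʳ (∂ H) H⋆A≐𝟙 n) (⋆-identityˡ (∂ H) n))) ⟩
            ((H ⋆ H) ⋆ ∂ A) n + ((H ⋆ A) ⋆ ∂ H) n
          ≈⟨ +-cong (trans (⋆-assoc H H (∂ A) n) (⋆-congˡ H (⋆-comm H (∂ A)) n))
                    (⋆-assoc H A (∂ H) n) ⟩
            (H ⋆ (∂ A ⋆ H)) n + (H ⋆ (A ⋆ ∂ H)) n
          ≈⟨ sym (⋆-distribˡ H (∂ A ⋆ H) (A ⋆ ∂ H) n) ⟩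
            (H ⋆ (∂ A ⋆ H ⊞ A ⋆ ∂ H)) n
          ≈⟨ ⋆-congˡ H (𝓢.sym (leibniz A H)) n ⟩
            (H ⋆ ∂ (A ⋆ H)) n
          ≈⟨ ⋆-congˡ H (𝓢.trans (∂-cong A⋆H≐𝟙) ∂-𝟙) n ⟩
            (H ⋆ 𝟘) n
          ≈⟨ 𝓢.zeroʳ H n ⟩
            0#
          ∎

    -- For any X, [t^{s+1}] X^{s+1} = [tˢ] Xˢ X′  (compare coefficients in the power rule).
    top-coefficient : ∀ X s → (X ^ suc s) (suc s) ≈ (X ^ s ⋆ ∂ X) s
    top-coefficient X s = ι-cancel s (∂-^ X s s)

    ∂u : ∂ u ≐ A ⊞ 𝐭 ⋆ ∂ A
    ∂u = 𝓢.trans (leibniz 𝐭 A) (𝓢.+-congʳ (𝓢.trans (⋆-congʳ A ∂𝐭) (⋆-identityˡ A)))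

    residue : ∀ s → (H ^ suc s ⋆ ∂ u) s ≈ unitS s
    residue zero = begin
        (H ^ 1 ⋆ ∂ u) 0
      ≈⟨ *-cong (^-constant H H₀≈1 1) (trans (∂u 0) (+-cong A₀≈1 (𝐭⋆-zero (∂ A)))) ⟩
        1# * (1# + 0#)
      ≈⟨ trans (*-identityˡ _) (+-identityʳ _) ⟩
        1#
      ∎
    residue (suc s) = begin
        (H ^ suc (suc s) ⋆ ∂ u) (suc s)
      ≈⟨ trans (⋆-congˡ (H ^ suc (suc s)) ∂u (suc s)) (⋆-distribˡ _ A (𝐭 ⋆ ∂ A) (suc s)) ⟩
        (H ^ suc (suc s) ⋆ A) (suc s) + (H ^ suc (suc s) ⋆ (𝐭 ⋆ ∂ A)) (suc s)
      ≈⟨ +-cong inverse-term derivative-term ⟩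
        (H ^ suc s) (suc s) - (H ^ suc s) (suc s)
      ≈⟨ -‿inverseʳ _ ⟩
        0#
      ∎
      where
        inverse-term : (H ^ suc (suc s) ⋆ A) (suc s) ≈ (H ^ suc s) (suc s)
        inverse-term = begin
            ((H ⋆ H ^ suc s) ⋆ A) (suc s)  ≈⟨ 𝓢-Rearrange.xy∙z≈y∙xz H (H ^ suc s) A (suc s) ⟩
            (H ^ suc s ⋆ (H ⋆ A)) (suc s)  ≈⟨ ⋆-congˡ (H ^ suc s) H⋆A≐𝟙 (suc s) ⟩
            (H ^ suc s ⋆ unitS) (suc s)    ≈⟨ ⋆-identityʳ _ (suc s) ⟩
            (H ^ suc s) (suc s)            ∎
        derivative-term : (H ^ suc (suc s) ⋆ (𝐭 ⋆ ∂ A)) (suc s) ≈ - (H ^ suc s) (suc s)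
        derivative-term = begin
            (H ^ (2 ℕ.+ s) ⋆ (𝐭 ⋆ ∂ A)) (suc s)    ≈⟨ 𝓢-Rearrange.x∙yz≈y∙xz _ 𝐭 (∂ A) (suc s) ⟩
            (𝐭 ⋆ (H ^ (2 ℕ.+ s) ⋆ ∂ A)) (suc s)    ≈⟨ 𝐭⋆-suc (H ^ (2 ℕ.+ s) ⋆ ∂ A) s ⟩
            (H ^ (2 ℕ.+ s) ⋆ ∂ A) s                ≈⟨ ⋆-congʳ (∂ A) (^-homo-* H 2 s) s ⟩
            ((H ^ 2 ⋆ H ^ s) ⋆ ∂ A) s              ≈⟨ 𝓢-Rearrange.xy∙z≈y∙xz (H ^ 2) (H ^ s) (∂ A) s ⟩
            (H ^ s ⋆ (H ^ 2 ⋆ ∂ A)) s              ≈⟨ ⋆-congˡ (H ^ s) ∂H s ⟩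
            (H ^ s ⋆ ⊟ ∂ H) s                      ≈⟨ 𝓢-Properties.-‿distribʳ-* (H ^ s) (∂ H) s ⟨
            - (H ^ s ⋆ ∂ H) s                      ≈⟨ -‿cong (top-coefficient H s) ⟨
            - (H ^ suc s) (suc s)                  ∎

    residue-powers : ∀ {i r} → i ≤ r → (∂ (u ^ suc i) ⋆ H ^ suc r) r ≈ ι (suc i) * unitS (r ∸ i)
    residue-powers {i} {r} i≤r =
      P.subst (λ m → (∂ (u ^ suc i) ⋆ H ^ suc m) m ≈ ι (suc i) * unitS (r ∸ i))
              (ℕP.m+[n∸m]≡n i≤r) (shifted (r ∸ i))
      where
        shifted : ∀ s → (∂ (u ^ suc i) ⋆ H ^ suc (i ℕ.+ s)) (i ℕ.+ s) ≈ ι (suc i) * unitS s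
        shifted s = begin
            (∂ (u ^ suc i) ⋆ Hⁿ) (i ℕ.+ s)
          ≈⟨ ⋆-scaleˡ (ι (suc i)) Hⁿ (u ^ i ⋆ ∂ u) _ (∂-^ u i) (i ℕ.+ s) ⟩
            ι (suc i) * ((u ^ i ⋆ ∂ u) ⋆ Hⁿ) (i ℕ.+ s)
          ≈⟨ *-congˡ (regroup (i ℕ.+ s)) ⟩
            ι (suc i) * (𝐭 ^ i ⋆ ((A ^ i ⋆ Hⁿ) ⋆ ∂ u)) (i ℕ.+ s)
          ≈⟨ *-congˡ (trans (𝐭^⋆ i ((A ^ i ⋆ Hⁿ) ⋆ ∂ u) (i ℕ.+ s) (ℕP.m≤m+n i s))
                            (reflexive (P.cong ((A ^ i ⋆ Hⁿ) ⋆ ∂ u) (ℕP.m+n∸m≡n i s)))) ⟩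
            ι (suc i) * ((A ^ i ⋆ Hⁿ) ⋆ ∂ u) s
          ≈⟨ *-congˡ (⋆-congʳ (∂ u) (𝓢.trans (⋆-congˡ (A ^ i) exponent) (cancel-powers i (suc s))) s) ⟩
            ι (suc i) * (H ^ suc s ⋆ ∂ u) s
          ≈⟨ *-congˡ (residue s) ⟩
            ι (suc i) * unitS s
          ∎
          where
            Hⁿ : Seq
            Hⁿ = H ^ suc (i ℕ.+ s)
            exponent : Hⁿ ≐ H ^ (i ℕ.+ suc s)
            exponent = 𝓢.reflexive (P.cong (H ^_) (P.sym (ℕP.+-suc i s)))
            regroup : (u ^ i ⋆ ∂ u) ⋆ Hⁿ ≐ 𝐭 ^ i ⋆ ((A ^ i ⋆ Hⁿ) ⋆ ∂ u)
            regroup = 𝓢.trans (⋆-congʳ Hⁿ (⋆-congʳ (∂ u) (^-distrib-* 𝐭 A i)))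
                     (𝓢.trans (𝓢.*-assoc (𝐭 ^ i ⋆ A ^ i) (∂ u) Hⁿ)
                     (𝓢.trans (𝓢.*-assoc (𝐭 ^ i) (A ^ i) (∂ u ⋆ Hⁿ))
                              (⋆-congˡ (𝐭 ^ i) (𝓢-Rearrange.x∙yz≈xz∙y (A ^ i) (∂ u) Hⁿ))))

    -- [tʳ] (F ∘ u)′ H^{r+1} = Σ_i F_i [tʳ] (uⁱ)′ H^{r+1}, in which only i = r+1 survives.
    ∂∘u-residue : ∀ r → (∂ (F ∘u) ⋆ H ^ suc r) r ≈ ∂ F r
    ∂∘u-residue r = begin
        (∂ (F ∘u) ⋆ H ^ suc r) r
      ≈⟨ ⋆-linearˡ (suc r) F (λ i → ∂ (u ^ i)) (∂ (F ∘u)) (H ^ suc r) r (λ l l≤r → ∂-∘u F (s≤s l≤r)) ⟩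
        sumTo r (λ i → F i * (∂ (u ^ i) ⋆ H ^ suc r) r) + F (suc r) * (∂ (u ^ suc r) ⋆ H ^ suc r) r
      ≈⟨ +-cong (sum-zero r lower-term) (*-congˡ (residue-powers {r} ℕP.≤-refl)) ⟩
        0# + F (suc r) * (ι (suc r) * unitS (r ∸ r))
      ≈⟨ trans (+-identityˡ _) (*-congˡ (*-congˡ (reflexive (P.cong unitS (ℕP.n∸n≡0 r))))) ⟩
        F (suc r) * (ι (suc r) * 1#)
      ≈⟨ trans (*-congˡ (*-identityʳ _)) (*-comm _ _) ⟩
        ∂ F r
      ∎
      where
        lower-term : ∀ i → i ≤ r → F i * (∂ (u ^ i) ⋆ H ^ suc r) r ≈ 0#
        lower-term zero    _     =
          trans (*-congˡ (trans (⋆-congʳ (H ^ suc r) ∂-𝟙 r) (𝓢.zeroˡ (H ^ suc r) r))) (zeroʳ _)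
        lower-term (suc j) 1+j≤r =
          trans (*-congˡ (trans (residue-powers (ℕP.<⇒≤ 1+j≤r)) (trans (*-congˡ (δ-off 1+j≤r)) (zeroʳ _))))
                (zeroʳ _)

    -- If F ∘ u and A agree up to degree r, they agree in degree r+1: the derivative of
    -- their difference, multiplied by H^{r+1}, has degree-r coefficient (r+1)·(difference)_{r+1}.
    next-coefficient : ∀ r → (∀ q → q ≤ r → (F ∘u) q ≈ A q) → (F ∘u) (suc r) ≈ A (suc r)
    next-coefficient r agree = x∙y⁻¹≈ε⇒x≈y _ _ (ι-cancel r (begin
        ι (suc r) * ((F ∘u) (suc r) - A (suc r))
      ≈⟨ x[y-z]≈xy-xz _ _ _ ⟩
        Δ r
      ≈⟨ sym (trans (⋆-leading Δ (H ^ suc r) r lower-vanish)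
                    (trans (*-congˡ (^-constant H H₀≈1 (suc r))) (*-identityʳ _))) ⟩
        (Δ ⋆ H ^ suc r) r
      ≈⟨ 𝓢-Properties.[y-z]x≈yx-zx (H ^ suc r) (∂ (F ∘u)) (∂ A) r ⟩
        (∂ (F ∘u) ⋆ H ^ suc r) r - (∂ A ⋆ H ^ suc r) r
      ≈⟨ +-cong (∂∘u-residue r) (-‿cong (sym (∂F r))) ⟩
        ∂ F r - ∂ F r
      ≈⟨ -‿inverseʳ _ ⟩
        0#
      ≈⟨ sym (zeroʳ _) ⟩
        ι (suc r) * 0#
      ∎))
      where
        Δ : Seq
        Δ = ∂ (F ∘u) 𝓢.- ∂ A
        lower-vanish : ∀ l → l < r → Δ l ≈ 0#
        lower-vanish l l<r =
          trans (sym (x[y-z]≈xy-xz _ _ _)) (trans (*-congˡ (x≈y⇒x∙y⁻¹≈ε (agree (suc l) l<r))) (zeroʳ _))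

    agree-upto : ∀ r q → q ≤ r → (F ∘u) q ≈ A q
    agree-upto zero    zero _ = trans (trans (*-cong F₀≈1 refl) (*-identityˡ _)) (sym A₀≈1)
    agree-upto (suc r) q q≤1+r with ℕP.m≤n⇒m<n∨m≡n q≤1+r
    ... | inj₁ q<1+r  = agree-upto r q (ℕP.≤-pred q<1+r)
    ... | inj₂ P.refl = next-coefficient r (agree-upto r)

    lagrange-inversion : F ∘u ≐ A
    lagrange-inversion q = agree-upto q q ℕP.≤-refl

  -- Given inverses invN n of n+1 in R, a moment
  -- sequence a becomes the series egf a with coefficients a_n / n!; this turns the
  -- binomial convolution of Defs into the Cauchy product.
  module ExponentialGeneratingFunctions
    (invN : ℕ → Carrier) (ι-inverse : ∀ n → ι (suc n) * invN n ≈ 1#) where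

    invFact : ℕ → Carrier
    invFact = factInv invN

    ι-cancel : ∀ n {x y} → ι (suc n) * x ≈ ι (suc n) * y → x ≈ y
    ι-cancel n {x} {y} nx≈ny = begin
        x                          ≈⟨ sym (trans (*-congʳ invN·ι≈1) (*-identityˡ x)) ⟩
        (invN n * ι (suc n)) * x   ≈⟨ *-assoc _ _ _ ⟩
        invN n * (ι (suc n) * x)   ≈⟨ *-congˡ nx≈ny ⟩
        invN n * (ι (suc n) * y)   ≈⟨ sym (*-assoc _ _ _) ⟩
        (invN n * ι (suc n)) * y   ≈⟨ trans (*-congʳ invN·ι≈1) (*-identityˡ y) ⟩
        y                          ∎
      where
        invN·ι≈1 : invN n * ι (suc n) ≈ 1#
        invN·ι≈1 = trans (*-comm _ _) (ι-inverse n)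

    invFact-inverse : ∀ n → ι (n !) * invFact n ≈ 1#
    invFact-inverse zero    = trans (*-identityʳ _) (+-identityʳ _)
    invFact-inverse (suc n) = begin
        ι (suc n ℕ.* n !) * (invN n * invFact n)
      ≈⟨ *-congʳ (ι-* (suc n) (n !)) ⟩
        (ι (suc n) * ι (n !)) * (invN n * invFact n)
      ≈⟨ interchange _ _ _ _ ⟩
        (ι (suc n) * invN n) * (ι (n !) * invFact n)
      ≈⟨ *-cong (ι-inverse n) (invFact-inverse n) ⟩
        1# * 1#
      ≈⟨ *-identityʳ _ ⟩
        1#
      ∎

    invFact-suc : ∀ n → invFact n ≈ ι (suc n) * invFact (suc n)
    invFact-suc n = sym (trans (sym (*-assoc _ _ _)) (trans (*-congʳ (ι-inverse n)) (*-identityˡ _)))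

    binomial-invFact : ∀ {j n} → j ≤ n → ι (n C j) * invFact n ≈ invFact j * invFact (n ∸ j)
    binomial-invFact {j} {n} j≤n = begin
        ι (n C j) * invFact n
      ≈⟨ sym (trans (*-congˡ (trans (*-cong (invFact-inverse j) (invFact-inverse (n ∸ j))) (*-identityʳ _)))
                    (*-identityʳ _)) ⟩
        (ι (n C j) * invFact n) * ((ι (j !) * invFact j) * (ι ((n ∸ j) !) * invFact (n ∸ j)))
      ≈⟨ solve 6 (λ c f p a q b → ((c ⊕ f) ⊕ ((p ⊕ a) ⊕ (q ⊕ b))) ⊜ (((c ⊕ (p ⊕ q)) ⊕ f) ⊕ (a ⊕ b)))
               refl _ _ _ _ _ _ ⟩
        ((ι (n C j) * (ι (j !) * ι ((n ∸ j) !))) * invFact n) * (invFact j * invFact (n ∸ j))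
      ≈⟨ *-congʳ (*-congʳ (sym (trans (reflexive (P.cong ι (P.sym n!-factorisation)))
                                      (trans (ι-* (n C j) _) (*-congˡ (ι-* (j !) _)))))) ⟩
        (ι (n !) * invFact n) * (invFact j * invFact (n ∸ j))
      ≈⟨ trans (*-congʳ (invFact-inverse n)) (*-identityˡ _) ⟩
        invFact j * invFact (n ∸ j)
      ∎
      where
        n!-factorisation : (n C j) ℕ.* (j ! ℕ.* (n ∸ j) !) ≡ n !
        n!-factorisation = P.trans (P.cong (ℕ._* (j ! ℕ.* (n ∸ j) !)) (nCk≡n!/k![n-k]! j≤n))
                                   (m/n*n≡m {{ℕP._!*_!≢0 j (n ∸ j)}} (k![n∸k]!∣n! j≤n))

    egf : Seq → Seq
    egf a n = a n * invFact n

    egf-conv : ∀ a b → egf (conv a b) ≐ egf a ⋆ egf b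
    egf-conv a b n = trans (sum-*ʳ n _ _) (sum-cong n (λ j j≤n → begin
        ι (n C j) * a j * b (n ∸ j) * invFact n
      ≈⟨ solve 4 (λ c x y f → (((c ⊕ x) ⊕ y) ⊕ f) ⊜ ((c ⊕ f) ⊕ (x ⊕ y))) refl _ _ _ _ ⟩
        (ι (n C j) * invFact n) * (a j * b (n ∸ j))
      ≈⟨ *-congʳ (binomial-invFact j≤n) ⟩
        (invFact j * invFact (n ∸ j)) * (a j * b (n ∸ j))
      ≈⟨ solve 4 (λ p q x y → ((p ⊕ q) ⊕ (x ⊕ y)) ⊜ ((x ⊕ p) ⊕ (y ⊕ q))) refl _ _ _ _ ⟩
        egf a j * egf b (n ∸ j)
      ∎))

    egf-unit : egf unitS ≐ unitS
    egf-unit zero    = *-identityʳ _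
    egf-unit (suc n) = zeroˡ _

    egf-pow : ∀ a k → egf (pow a k) ≐ egf a ^ k
    egf-pow a zero    = egf-unit
    egf-pow a (suc k) = 𝓢.trans (egf-conv a (pow a k)) (⋆-congˡ (egf a) (egf-pow a k))

    egf-shift : ∀ a → egf (λ n → a (suc n)) ≐ ∂ (egf a)
    egf-shift a n = trans (*-congˡ (invFact-suc n)) (x∙yz≈y∙xz _ _ _)

    riordan-coefficient : ∀ cs cinv γ α n k →
      riordan invN cs cinv γ α n k ≈ cs n * cinv k * (egf γ ⋆ egf α ^ k) (n ∸ k)
    riordan-coefficient cs cinv γ α n k = trans (*-assoc _ _ _) (*-congˡ
      (trans (egf-conv γ (pow α k) (n ∸ k)) (⋆-congˡ (egf γ) (egf-pow α k) (n ∸ k))))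

    -- The series attached to an umbra α (with E[α⁰] = 1): A = f_α, H = 1/f_α = f_{(-1).α}
    -- and F = f_{𝔎_α}.  By Lagrange inversion F(t f_α(t)) = f_α(t).
    module UmbraSeries (α : Seq) (α₀≈1 : α 0 ≈ 1#) where

      A H F : Seq
      A = egf α
      H = egf (invS α)
      F = egf (kappaSelf α)

      -- E = 1 - A; invS α is built so that H is the geometric series of E.
      E : Seq
      E = egf (λ j → unitS j - α j)

      E₀≈0 : E 0 ≈ 0#
      E₀≈0 = trans (*-identityʳ _) (trans (+-congˡ (-‿cong α₀≈1)) (-‿inverseʳ _))

      A≐𝟙-E : A ≐ unitS 𝓢.- E
      A≐𝟙-E j = x≈z//y (A j) (E j) (unitS j) (begin
          α j * invFact j + (unitS j - α j) * invFact j  ≈⟨ +-comm _ _ ⟩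
          (unitS j - α j) * invFact j + α j * invFact j  ≈⟨ sym (distribʳ _ _ _) ⟩
          ((unitS j - α j) + α j) * invFact j            ≈⟨ *-congʳ (//-rightDividesˡ (α j) (unitS j)) ⟩
          unitS j * invFact j                            ≈⟨ egf-unit j ⟩
          unitS j                                        ∎)

      H≐geometric : H ≐ geometric E
      H≐geometric n = trans (sum-*ʳ n _ _) (sum-cong′ n (λ m → egf-pow (λ j → unitS j - α j) m n))

      A⋆H≐𝟙 : A ⋆ H ≐ unitS
      A⋆H≐𝟙 = 𝓢.trans (⋆-cong A≐𝟙-E H≐geometric) (geometric-inverse E E₀≈0)

      -- 𝔎_α^{r+1} ≃ α (α + (-(r+1)).α)^r  says exactly  F′_r = [tʳ] A′ H^{r+1}.
      ∂F : ∀ r → ∂ F r ≈ (∂ A ⋆ H ^ suc r) r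
      ∂F r = begin
          ∂ F r
        ≈⟨ sym (egf-shift (kappaSelf α) r) ⟩
          egf (conv (λ j → α (suc j)) (pow (invS α) (suc r))) r
        ≈⟨ egf-conv (λ j → α (suc j)) (pow (invS α) (suc r)) r ⟩
          (egf (λ j → α (suc j)) ⋆ egf (pow (invS α) (suc r))) r
        ≈⟨ ⋆-cong (egf-shift α) (egf-pow (invS α) (suc r)) r ⟩
          (∂ A ⋆ H ^ suc r) r
        ∎

      F₀≈1 : F 0 ≈ 1#
      F₀≈1 = *-identityʳ _

      open LagrangeInversion ι-cancel A H F (trans (*-identityʳ _) α₀≈1) A⋆H≐𝟙 F₀≈1 ∂F
        using (u; lagrange-inversion)
      open Composition u (𝐭⋆-zero A) using (_∘u; ∘u-extend; ^-∘u)

      u^⋆ : ∀ i X q → i ≤ q → (u ^ i ⋆ X) q ≈ (X ⋆ A ^ i) (q ∸ i)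
      u^⋆ i X q i≤q = begin
          (u ^ i ⋆ X) q                ≈⟨ ⋆-congʳ X (^-distrib-* 𝐭 A i) q ⟩
          ((𝐭 ^ i ⋆ A ^ i) ⋆ X) q      ≈⟨ ⋆-assoc (𝐭 ^ i) (A ^ i) X q ⟩
          (𝐭 ^ i ⋆ (A ^ i ⋆ X)) q      ≈⟨ 𝐭^⋆ i (A ^ i ⋆ X) q i≤q ⟩
          (A ^ i ⋆ X) (q ∸ i)          ≈⟨ ⋆-comm (A ^ i) X (q ∸ i) ⟩
          (X ⋆ A ^ i) (q ∸ i)          ∎

      -- Aᵏ = Fᵏ ∘ u, read off coefficientwise after multiplying by any series G.
      coefficient-identity : ∀ G k m → (G ⋆ A ^ k) m ≈ sumTo m (λ i → (F ^ k) i * (G ⋆ A ^ i) (m ∸ i))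
      coefficient-identity G k m = begin
          (G ⋆ A ^ k) m
        ≈⟨ ⋆-comm G (A ^ k) m ⟩
          (A ^ k ⋆ G) m
        ≈⟨ ⋆-congʳ G (𝓢.trans (^-congˡ k (𝓢.sym lagrange-inversion)) (𝓢.sym (^-∘u F k))) m ⟩
          ((F ^ k) ∘u ⋆ G) m
        ≈⟨ ⋆-linearˡ m (F ^ k) (u ^_) ((F ^ k) ∘u) G m (λ l l≤m → ∘u-extend (F ^ k) l≤m) ⟩
          sumTo m (λ i → (F ^ k) i * (u ^ i ⋆ G) m)
        ≈⟨ sum-cong m (λ i i≤m → *-congˡ (u^⋆ i G m i≤m)) ⟩
          sumTo m (λ i → (F ^ k) i * (G ⋆ A ^ i) (m ∸ i))
        ∎

      weighted-entry : ∀ cs cinv → (∀ n → cs n * cinv n ≈ 1#) → ∀ γ k m i →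
        cs i * pow (kappaSelf α) k i * invFact i * riordan invN cs cinv γ α m i
          ≈ cs m * ((F ^ k) i * (egf γ ⋆ A ^ i) (m ∸ i))
      weighted-entry cs cinv cs-inverse γ k m i = begin
          cs i * pow (kappaSelf α) k i * invFact i * riordan invN cs cinv γ α m i
        ≈⟨ *-cong (trans (*-assoc _ _ _) (*-congˡ (egf-pow (kappaSelf α) k i)))
                  (riordan-coefficient cs cinv γ α m i) ⟩
          cs i * (F ^ k) i * (cs m * cinv i * coefficient)
        ≈⟨ solve 5 (λ a f b c y → ((a ⊕ f) ⊕ ((b ⊕ c) ⊕ y)) ⊜ ((a ⊕ c) ⊕ (b ⊕ (f ⊕ y))))
                 refl _ _ _ _ _ ⟩
          (cs i * cinv i) * (cs m * ((F ^ k) i * coefficient))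
        ≈⟨ trans (*-congʳ (cs-inverse i)) (*-identityˡ _) ⟩
          cs m * ((F ^ k) i * coefficient)
        ∎
        where
          coefficient : Carrier
          coefficient = (egf γ ⋆ A ^ i) (m ∸ i)

-- Corollary 3.15.  Rewrite the entry as c_n/c_k · [tᵐ] f_γ f_αᵏ (m = n - k), expand
-- by the coefficient identity, and insert c_m/c_m to recognise each summand.
corollary3p15 : ∀ {c ℓ : Level} (R : CommutativeRing c ℓ) →
    let open CommutativeRing R
        open Umbral R
    in (invN : ℕ → Carrier) → (∀ n → ι (suc n) * invN n ≈ 1#) →
       (cs cinv : ℕ → Carrier) → cs 0 ≈ 1# → (∀ n → cs n * cinv n ≈ 1#) →
       (ω : ℕ → Carrier) → (∀ n → ω n ≈ ι (n !) * cinv n) →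
       (γ α : ℕ → Carrier) → γ 0 ≈ 1# → α 0 ≈ 1# →
       ∀ n k → k ≤ n →
       riordan invN cs cinv γ α n k
         ≈ cs n * (cinv k * cinv (n ∸ k))
           * sumTo (n ∸ k) (λ i → cs i * pow (kappaSelf α) k i * factInv invN i
                                       * riordan invN cs cinv γ α (n ∸ k) i)
corollary3p15 R invN ι-inverse cs cinv _ cs-inverse _ _ γ α _ α₀≈1 n k _ = begin
    riordan invN cs cinv γ α n k
  ≈⟨ riordan-coefficient cs cinv γ α n k ⟩
    cs n * cinv k * (egf γ ⋆ A ^ k) m
  ≈⟨ *-congˡ (coefficient-identity (egf γ) k m) ⟩
    cs n * cinv k * Σ
  ≈⟨ *-congˡ (sym (trans (*-congʳ (cs-inverse m)) (*-identityˡ Σ))) ⟩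
    cs n * cinv k * ((cs m * cinv m) * Σ)
  ≈⟨ solve 5 (λ a b c d x → ((a ⊕ b) ⊕ ((c ⊕ d) ⊕ x)) ⊜ ((a ⊕ (b ⊕ d)) ⊕ (c ⊕ x))) refl _ _ _ _ _ ⟩
    cs n * (cinv k * cinv m) * (cs m * Σ)
  ≈⟨ *-congˡ (trans (sum-*ˡ m _ _) (sum-cong′ m (λ i → sym (weighted-entry cs cinv cs-inverse γ k m i)))) ⟩
    cs n * (cinv k * cinv m)
      * sumTo m (λ i → cs i * pow (kappaSelf α) k i * factInv invN i * riordan invN cs cinv γ α m i)
  ∎
  where
    open CommutativeRing R
    open Umbral R
    open FormalPowerSeries R
    open ExponentialGeneratingFunctions invN ι-inverse
    open UmbraSeries α α₀≈1
    open import Relation.Binary.Reasoning.Setoid setoid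
    open CommutativeMonoidSolver *-commutativeMonoid using (solve; _⊕_; _⊜_)
    m : ℕ
    m = n ∸ k
    Σ : Carrier
    Σ = sumTo m (λ i → (F ^ k) i * (egf γ ⋆ A ^ i) (m ∸ i))
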